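{- There exists a constant $C_0$ such that the following holds. Let $A, B, C, p, q, r, n$ be nonnegative integers such that $n \ge C_0$, $n = p + q + r$, $$A = \tfrac{5}{4}n - \tfrac{25}{32}p - \tfrac{25}{4}r,\qquad B = -\tfrac{5}{4}n + \tfrac{25}{16}p + \tfrac{25}{4}r,\qquad C = \tfrac{1}{2}n - \tfrac{25}{32}p.$$ Then the coefficient of the monomial $x^p y^q z^r$ in the polynomial $$P(x,y,z) = (x^2 + 2y^2 + z^2)^A\,(x^2 + (y+z)^2)^B\,((2y+z)^2)^C$$ is at least $\frac{1}{n^{C_0}}\cdot \frac{5^n}{2^{2p+q}}$. -}

module Defs where

open import Data.Nat using (ℕ; zero; suc; _+_; _*_; _∸_; _≟_)
open import Data.Bool using (if_then_else_; _∧_)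
open import Relation.Nullary.Decidable using (⌊_⌋)

-- Polynomials in three variables x, y, z with natural-number coefficients,
-- represented by their coefficient function: P a b c = coefficient of x^a y^b z^c.
Poly : Set
Poly = ℕ → ℕ → ℕ → ℕ

sumTo : ℕ → (ℕ → ℕ) → ℕ
sumTo zero    f = f 0
sumTo (suc n) f = sumTo n f + f (suc n)

mono : ℕ → ℕ → ℕ → Poly
mono i j k a b c = if ⌊ a ≟ i ⌋ ∧ ⌊ b ≟ j ⌋ ∧ ⌊ c ≟ k ⌋ then 1 else 0

infixl 6 _⊕_
infixl 7 _⊗_ _⊙_

_⊕_ : Poly → Poly → Poly
(f ⊕ g) a b c = f a b c + g a b c

_⊙_ : ℕ → Poly → Poly
(s ⊙ f) a b c = s * f a b c

_⊗_ : Poly → Poly → Poly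
(f ⊗ g) a b c =
  sumTo a λ i → sumTo b λ j → sumTo c λ k →
    f i j k * g (a ∸ i) (b ∸ j) (c ∸ k)

one : Poly
one = mono 0 0 0

_^ᴾ_ : Poly → ℕ → Poly
f ^ᴾ zero  = one
f ^ᴾ suc n = f ⊗ (f ^ᴾ n)

X Y Z : Poly
X = mono 1 0 0
Y = mono 0 1 0
Z = mono 0 0 1

sq : Poly → Poly
sq f = f ⊗ f

P : ℕ → ℕ → ℕ → Poly
P A B C =
  ((sq X ⊕ 2 ⊙ sq Y ⊕ sq Z) ^ᴾ A)
  ⊗ ((sq X ⊕ sq (Y ⊕ Z)) ^ᴾ B)
  ⊗ ((sq (2 ⊙ Y ⊕ Z)) ^ᴾ C)

{-# OPTIONS --safe #-}

-- Every coefficient of P is a sum of products of nonnegative numbers, so it is at least the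
-- product of the coefficients of one monomial chosen in each of the three powers.  Writing
-- A = 25α + a, B = 25β + b and C = 5γ + c, we choose the monomials in the proportions of the
-- largest terms: x² : y² : z² = 16 : 8 : 1 in (x² + 2y² + z²)^A, x² : (y + z)² = 16 : 9 and then
-- y : z = 2 : 1 in (x² + (y + z)²)^B, and y : z = 4 : 1 in (2y + z)^(2C); the residues (a, b, c)
-- are covered by a fixed choice, and only five of them are compatible with the hypotheses.  With
-- these proportions each binomial coefficient, times the matching powers, is the largest term of
-- the expansion of some (u + w)^M, hence at least (u + w)^M / (M + 1), and multiplying these
-- bounds gives 5^n / 2^(2p+q) up to a polynomial factor in n.

module Submission where

open import Defs
open import Data.Nat using (ℕ; zero; suc; _+_; _*_; _∸_; _^_; _≤_; _<_; _>_; z≤n; s≤s; _!; _<?_; _≤?_;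
                            >-nonZero; _/_; _%_)
open import Data.Nat.Properties
open import Data.Nat.Combinatorics using (nCk+nC[k+1]≡[n+1]C[k+1]; k>n⇒nCk≡0; nCk≡n!/k![n-k]!; k![n∸k]!∣n!)
                                   renaming (_C_ to _choose_)
open import Data.Nat.DivMod using (m/n*n≡m; m≡m%n+[m/n]*n; m%n<n)
open import Data.Nat.Divisibility using (_∣_; _∣?_; ∣m+n∣m⇒∣n; m∣m*n)
open import Data.Nat.Tactic.RingSolver using (solve; solve-∀)
open import Data.Bool using (T)
open import Data.Fin using (Fin; toℕ)
open import Data.List using (_∷_; [])
open import Data.Maybe using (Maybe; just; nothing; is-just; to-witness-T)
open import Data.Product using (∃-syntax; Σ-syntax; _×_; _,_; proj₁; proj₂)
open import Data.Sum using (inj₁; inj₂)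
open import Relation.Nullary using (yes; no)
open import Relation.Nullary.Decidable using (from-yes; _→-dec_; _×-dec_; T?)
open import Relation.Binary.PropositionalEquality
open import Algebra.Properties.CommutativeSemigroup +-commutativeSemigroup
  using () renaming (interchange to +-interchange)
open import Algebra.Properties.CommutativeSemigroup *-commutativeSemigroup
  using () renaming (x∙yz≈y∙xz to *-exchange)
open import Algebra.Properties.CommutativeSemiring.Binomial +-*-commutativeSemiring
  using () renaming (theorem to semiring-binomial-theorem)
open import Algebra.Properties.Semiring.Exp +-*-semiring using () renaming (_^_ to _^′_)
open import Algebra.Properties.Semiring.Mult +-*-semiring using () renaming (_×_ to _×′_)
open import Algebra.Properties.Semiring.Sum +-*-semiring using (sum; sum-cong-≗)

open ≤-Reasoning

sumTo-cong : ∀ n {f g : ℕ → ℕ} → (∀ i → f i ≡ g i) → sumTo n f ≡ sumTo n g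
sumTo-cong zero    f≗g = f≗g 0
sumTo-cong (suc n) f≗g = cong₂ _+_ (sumTo-cong n f≗g) (f≗g (suc n))

sumTo-mono-≤ : ∀ n {f g : ℕ → ℕ} → (∀ i → f i ≤ g i) → sumTo n f ≤ sumTo n g
sumTo-mono-≤ zero    f≤g = f≤g 0
sumTo-mono-≤ (suc n) f≤g = +-mono-≤ (sumTo-mono-≤ n f≤g) (f≤g (suc n))

sumTo-distrib-+ : ∀ n (f g : ℕ → ℕ) → sumTo n (λ i → f i + g i) ≡ sumTo n f + sumTo n g
sumTo-distrib-+ zero    f g = refl
sumTo-distrib-+ (suc n) f g =
  trans (cong (_+ (f (suc n) + g (suc n))) (sumTo-distrib-+ n f g))
        (+-interchange (sumTo n f) (sumTo n g) (f (suc n)) (g (suc n)))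

*-distribˡ-sumTo : ∀ n s (f : ℕ → ℕ) → s * sumTo n f ≡ sumTo n (λ i → s * f i)
*-distribˡ-sumTo zero    s f = refl
*-distribˡ-sumTo (suc n) s f =
  trans (*-distribˡ-+ s (sumTo n f) (f (suc n))) (cong (_+ s * f (suc n)) (*-distribˡ-sumTo n s f))

≤-sumTo : ∀ {n} (f : ℕ → ℕ) {i} → i ≤ n → f i ≤ sumTo n f
≤-sumTo {zero}  f z≤n = ≤-refl
≤-sumTo {suc n} f {i} i≤1+n with m≤n⇒m<n∨m≡n i≤1+n
... | inj₁ (s≤s i≤n) = ≤-trans (≤-sumTo f i≤n) (m≤m+n _ _)
... | inj₂ refl      = m≤n+m _ _

∑³ : ℕ → ℕ → ℕ → (ℕ → ℕ → ℕ → ℕ) → ℕ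
∑³ a b c F = sumTo a λ i → sumTo b λ j → sumTo c λ k → F i j k

∑³-cong : ∀ a b c {F G : ℕ → ℕ → ℕ → ℕ} → (∀ i j k → F i j k ≡ G i j k) →
          ∑³ a b c F ≡ ∑³ a b c G
∑³-cong a b c F≗G = sumTo-cong a λ i → sumTo-cong b λ j → sumTo-cong c λ k → F≗G i j k

∑³-mono-≤ : ∀ a b c {F G : ℕ → ℕ → ℕ → ℕ} → (∀ i j k → F i j k ≤ G i j k) →
            ∑³ a b c F ≤ ∑³ a b c G
∑³-mono-≤ a b c F≤G = sumTo-mono-≤ a λ i → sumTo-mono-≤ b λ j → sumTo-mono-≤ c λ k → F≤G i j k

∑³-distrib-+ : ∀ a b c (F G : ℕ → ℕ → ℕ → ℕ) →
               ∑³ a b c (λ i j k → F i j k + G i j k) ≡ ∑³ a b c F + ∑³ a b c G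
∑³-distrib-+ a b c F G =
  trans (sumTo-cong a λ i → trans (sumTo-cong b λ j → sumTo-distrib-+ c (F i j) (G i j))
                                  (sumTo-distrib-+ b _ _))
        (sumTo-distrib-+ a _ _)

≤-∑³ : ∀ {a b c} (F : ℕ → ℕ → ℕ → ℕ) {i j k} → i ≤ a → j ≤ b → k ≤ c →
       F i j k ≤ ∑³ a b c F
≤-∑³ {a} {b} {c} F {i} {j} i≤a j≤b k≤c =
  ≤-trans (≤-sumTo (F i j) k≤c)
  (≤-trans (≤-sumTo (λ j → sumTo c (F i j)) j≤b) (≤-sumTo (λ i → sumTo b λ j → sumTo c (F i j)) i≤a))

infix 4 _≤ᴾ_

_≤ᴾ_ : Poly → Poly → Set
f ≤ᴾ g = ∀ a b c → f a b c ≤ g a b c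

⊗-distribʳ-⊕ : ∀ f g h a b c → ((f ⊕ g) ⊗ h) a b c ≡ (f ⊗ h) a b c + (g ⊗ h) a b c
⊗-distribʳ-⊕ f g h a b c =
  trans (∑³-cong a b c λ i j k → *-distribʳ-+ (h (a ∸ i) (b ∸ j) (c ∸ k)) (f i j k) (g i j k))
        (∑³-distrib-+ a b c _ _)

⊗-distribˡ-⊕ : ∀ f g h a b c → (f ⊗ (g ⊕ h)) a b c ≡ (f ⊗ g) a b c + (f ⊗ h) a b c
⊗-distribˡ-⊕ f g h a b c =
  trans (∑³-cong a b c λ i j k →
           *-distribˡ-+ (f i j k) (g (a ∸ i) (b ∸ j) (c ∸ k)) (h (a ∸ i) (b ∸ j) (c ∸ k)))
        (∑³-distrib-+ a b c _ _)

⊗-monoˡ-≤ : ∀ {f g} h → f ≤ᴾ g → f ⊗ h ≤ᴾ g ⊗ h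
⊗-monoˡ-≤ h f≤g a b c = ∑³-mono-≤ a b c λ i j k → *-monoˡ-≤ (h (a ∸ i) (b ∸ j) (c ∸ k)) (f≤g i j k)

*≤⊗ : ∀ f g i j k a b c → f i j k * g a b c ≤ (f ⊗ g) (i + a) (j + b) (k + c)
*≤⊗ f g i j k a b c = begin
  f i j k * g a b c
    ≡⟨ cong (λ c′ → f i j k * g a b c′) (m+n∸m≡n k c) ⟨
  f i j k * g a b (k + c ∸ k)
    ≡⟨ cong₂ (λ a′ b′ → f i j k * g a′ b′ (k + c ∸ k)) (m+n∸m≡n i a) (m+n∸m≡n j b) ⟨
  f i j k * g (i + a ∸ i) (j + b ∸ j) (k + c ∸ k)
    ≤⟨ ≤-∑³ (λ i′ j′ k′ → f i′ j′ k′ * g (i + a ∸ i′) (j + b ∸ j′) (k + c ∸ k′))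
            (m≤m+n i a) (m≤m+n j b) (m≤m+n k c) ⟩
  (f ⊗ g) (i + a) (j + b) (k + c) ∎

x⁰-⊗-≤ : ∀ f g h s a b c → (∀ b′ c′ → s * h 0 b′ c′ ≤ g a b′ c′) →
         s * (f ⊗ h) 0 b c ≤ (f ⊗ g) a b c
x⁰-⊗-≤ f g h s a b c s*h≤g = begin
  s * (f ⊗ h) 0 b c
    ≡⟨ trans (*-distribˡ-sumTo b s _)
             (sumTo-cong b λ j → *-distribˡ-sumTo c s (λ k → f 0 j k * h 0 (b ∸ j) (c ∸ k))) ⟩
  sumTo b (λ j → sumTo c λ k → s * (f 0 j k * h 0 (b ∸ j) (c ∸ k)))
    ≤⟨ sumTo-mono-≤ b (λ j → sumTo-mono-≤ c λ k →
         ≤-trans (≤-reflexive (*-exchange s (f 0 j k) _)) (*-monoʳ-≤ (f 0 j k) (s*h≤g (b ∸ j) (c ∸ k)))) ⟩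
  sumTo b (λ j → sumTo c λ k → f 0 j k * g a (b ∸ j) (c ∸ k))
    ≤⟨ ≤-sumTo {a} (λ i → sumTo b λ j → sumTo c λ k → f i j k * g (a ∸ i) (b ∸ j) (c ∸ k)) z≤n ⟩
  (f ⊗ g) a b c ∎

-- shift e F j is the coefficient of t^j in t^e F(t).
shift : ℕ → (ℕ → ℕ) → ℕ → ℕ
shift zero    F j       = F j
shift (suc e) F zero    = 0
shift (suc e) F (suc j) = shift e F j

*-shift-≤ : ∀ s e F j {x} → (∀ j′ → j ≡ e + j′ → s * F j′ ≤ x) → s * shift e F j ≤ x
*-shift-≤ s zero    F j       s*F≤x = s*F≤x j refl
*-shift-≤ s (suc e) F zero    s*F≤x = ≤-trans (≤-reflexive (*-zeroʳ s)) z≤n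
*-shift-≤ s (suc e) F (suc j) s*F≤x = *-shift-≤ s e F j λ j′ eq → s*F≤x j′ (cong suc eq)

⊗-shift-≤ : ∀ f g a b j l {s} → s ≤ f 0 a b →
            s * shift a (λ j′ → shift b (g 0 j′) l) j ≤ (f ⊗ g) 0 j l
⊗-shift-≤ f g a b j l {s} s≤f =
  *-shift-≤ s a (λ j′ → shift b (g 0 j′) l) j λ { j′ refl →
  *-shift-≤ s b (g 0 j′) l λ { l′ refl → ≤-trans (*-monoˡ-≤ _ s≤f) (*≤⊗ f g 0 a b 0 j′ l′) } }

sq-⊕-≥ : ∀ P Q → (P ⊗ P ⊕ P ⊗ Q) ⊕ (Q ⊗ P ⊕ Q ⊗ Q) ≤ᴾ sq (P ⊕ Q)
sq-⊕-≥ P Q a b c = ≤-reflexive (sym (trans (⊗-distribʳ-⊕ P Q (P ⊕ Q) a b c)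
                                          (cong₂ _+_ (⊗-distribˡ-⊕ P P Q a b c) (⊗-distribˡ-⊕ Q P Q a b c))))

pascal : ∀ n j → suc n choose j ≡ shift 1 (n choose_) j + (n choose j)
pascal n zero    = refl
pascal n (suc j) = sym (nCk+nC[k+1]≡[n+1]C[k+1] n j)

pascal² : ∀ n j → suc (suc n) choose j ≡
                  shift 2 (n choose_) j + shift 1 (n choose_) j + (shift 1 (n choose_) j + (n choose j))
pascal² n j = trans (pascal (suc n) j) (cong₂ _+_ (shifted j) (pascal n j))
  where
  shifted : ∀ j → shift 1 (suc n choose_) j ≡ shift 2 (n choose_) j + shift 1 (n choose_) j
  shifted zero    = refl
  shifted (suc j) = pascal n j

m′Ci′≤[m+m′]C[i+i′] : ∀ m m′ i i′ → i ≤ m → m′ choose i′ ≤ (m + m′) choose (i + i′)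
m′Ci′≤[m+m′]C[i+i′] zero    m′ zero    i′ z≤n = ≤-refl
m′Ci′≤[m+m′]C[i+i′] (suc m) m′ zero    i′ z≤n = begin
  m′ choose i′                                          ≤⟨ m′Ci′≤[m+m′]C[i+i′] m m′ zero i′ z≤n ⟩
  (m + m′) choose i′                                    ≤⟨ m≤n+m _ _ ⟩
  shift 1 ((m + m′) choose_) i′ + ((m + m′) choose i′)  ≡⟨ pascal (m + m′) i′ ⟨
  suc (m + m′) choose i′                                ∎
m′Ci′≤[m+m′]C[i+i′] (suc m) m′ (suc i) i′ (s≤s i≤m) = begin
  m′ choose i′                                              ≤⟨ m′Ci′≤[m+m′]C[i+i′] m m′ i i′ i≤m ⟩
  (m + m′) choose (i + i′)                                  ≤⟨ m≤m+n _ _ ⟩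
  ((m + m′) choose (i + i′)) + ((m + m′) choose suc (i + i′))
                                                            ≡⟨ nCk+nC[k+1]≡[n+1]C[k+1] (m + m′) (i + i′) ⟩
  suc (m + m′) choose suc (i + i′)                          ∎

nCk*[k!*[n∸k]!]≡n! : ∀ {n k} → k ≤ n → (n choose k) * (k ! * (n ∸ k) !) ≡ n !
nCk*[k!*[n∸k]!]≡n! {n} {k} k≤n =
  trans (cong (_* (k ! * (n ∸ k) !)) (nCk≡n!/k![n-k]! k≤n))
        (m/n*n≡m {{k !* (n ∸ k) !≢0}} (k![n∸k]!∣n! k≤n))

nC[1+k]*[1+k]≡nCk*[n∸k] : ∀ n k → (n choose suc k) * suc k ≡ (n choose k) * (n ∸ k)
nC[1+k]*[1+k]≡nCk*[n∸k] n k with k <? n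
... | no k≮n = begin-equality
  (n choose suc k) * suc k  ≡⟨ cong (_* suc k) (k>n⇒nCk≡0 (s≤s (≮⇒≥ k≮n))) ⟩
  0                         ≡⟨ *-zeroʳ (n choose k) ⟨
  (n choose k) * 0          ≡⟨ cong ((n choose k) *_) (m≤n⇒m∸n≡0 (≮⇒≥ k≮n)) ⟨
  (n choose k) * (n ∸ k)    ∎
... | yes k<n = *-cancelʳ-≡ _ _ (k ! * (n ∸ suc k) !) {{k !* (n ∸ suc k) !≢0}} (begin-equality
  (n choose suc k) * suc k * (k ! * (n ∸ suc k) !)      ≡⟨ regroup (n choose suc k) (suc k) (k !) ((n ∸ suc k) !) ⟩
  (n choose suc k) * (suc k ! * (n ∸ suc k) !)          ≡⟨ nCk*[k!*[n∸k]!]≡n! k<n ⟩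
  n !                                                   ≡⟨ nCk*[k!*[n∸k]!]≡n! (<⇒≤ k<n) ⟨
  (n choose k) * (k ! * (n ∸ k) !)                      ≡⟨ cong (λ d → (n choose k) * (k ! * d !)) n∸k≡1+d ⟩
  (n choose k) * (k ! * suc d !)                        ≡⟨ regroup′ (n choose k) (suc d) (k !) (d !) ⟩
  (n choose k) * suc d * (k ! * d !)                    ≡⟨ cong (λ e → (n choose k) * e * (k ! * d !)) n∸k≡1+d ⟨
  (n choose k) * (n ∸ k) * (k ! * (n ∸ suc k) !)        ∎)
  where
  d = n ∸ suc k
  n∸k≡1+d : n ∸ k ≡ suc d
  n∸k≡1+d = +-∸-assoc 1 k<n
  regroup : ∀ x s f g → x * s * (f * g) ≡ x * (s * f * g)
  regroup = solve-∀
  regroup′ : ∀ x s f g → x * (f * (s * g)) ≡ x * s * (f * g)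
  regroup′ = solve-∀

module Row (u v : ℕ) where

  Row≤ : ℕ → (ℕ → ℕ → ℕ) → Set
  Row≤ n R = ∀ j l → j + l ≡ n → (n choose j) * u ^ j * v ^ l ≤ R j l

  Row≤-mono : ∀ {n R R′} → Row≤ n R → (∀ j l → R j l ≤ R′ j l) → Row≤ n R′
  Row≤-mono R≤ R≤R′ j l eq = ≤-trans (R≤ j l eq) (R≤R′ j l)

  shift-row-≤ : ∀ {n R} → Row≤ n R → ∀ a b j l → j + l ≡ a + b + n →
                shift a (n choose_) j * u ^ j * v ^ l ≤ u ^ a * v ^ b * shift a (λ j′ → shift b (R j′) l) j
  shift-row-≤ R≤ (suc a) b zero l eq = z≤n
  shift-row-≤ {n} {R} R≤ (suc a) b (suc j) l eq = begin
    shift a (n choose_) j * (u * u ^ j) * v ^ l  ≡⟨ pull u (shift a (n choose_) j) (u ^ j) (v ^ l) ⟩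
    u * (shift a (n choose_) j * u ^ j * v ^ l)  ≤⟨ *-monoʳ-≤ u (shift-row-≤ R≤ a b j l (suc-injective eq)) ⟩
    u * (u ^ a * v ^ b * shift a S j)            ≡⟨ pull′ u (u ^ a) (v ^ b) (shift a S j) ⟩
    u * u ^ a * v ^ b * shift a S j              ∎
    where
    S = λ j′ → shift b (R j′) l
    pull : ∀ u x y z → x * (u * y) * z ≡ u * (x * y * z)
    pull = solve-∀
    pull′ : ∀ u x y z → u * (x * y * z) ≡ u * x * y * z
    pull′ = solve-∀
  shift-row-≤ R≤ zero zero j l eq = ≤-trans (R≤ j l eq) (≤-reflexive (sym (*-identityˡ _)))
  shift-row-≤ {n} R≤ zero (suc b) j zero eq = begin
    (n choose j) * u ^ j * 1  ≡⟨ cong (λ x → x * u ^ j * 1) (k>n⇒nCk≡0 j>n) ⟩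
    0                         ≤⟨ z≤n ⟩
    _                         ∎
    where
    j>n : j > n
    j>n = ≤-trans (s≤s (m≤n+m n b)) (≤-reflexive (sym (trans (sym (+-identityʳ j)) eq)))
  shift-row-≤ {n} {R} R≤ zero (suc b) j (suc l) eq = begin
    (n choose j) * u ^ j * (v * v ^ l)  ≡⟨ pull v ((n choose j) * u ^ j) (v ^ l) ⟩
    v * ((n choose j) * u ^ j * v ^ l)  ≤⟨ *-monoʳ-≤ v (shift-row-≤ R≤ zero b j l j+l≡b+n) ⟩
    v * (1 * v ^ b * shift b (R j) l)   ≡⟨ pull′ v (v ^ b) (shift b (R j) l) ⟩
    1 * (v * v ^ b) * shift b (R j) l   ∎
    where
    j+l≡b+n = suc-injective (trans (sym (+-suc j l)) eq)
    pull : ∀ v x y → x * (v * y) ≡ v * (x * y)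
    pull = solve-∀
    pull′ : ∀ v x y → v * (1 * x * y) ≡ 1 * (v * x) * y
    pull′ = solve-∀

  pascal-row : ∀ {n R} → Row≤ n R →
               Row≤ (suc n) (λ j l → u * shift 1 (λ j′ → R j′ l) j + v * shift 1 (R j) l)
  pascal-row {n} {R} R≤ j l eq = begin
    (suc n choose j) * u ^ j * v ^ l
      ≡⟨ cong (λ x → x * u ^ j * v ^ l) (pascal n j) ⟩
    (shift 1 (n choose_) j + (n choose j)) * u ^ j * v ^ l
      ≡⟨ distrib (shift 1 (n choose_) j) (n choose j) (u ^ j) (v ^ l) ⟩
    shift 1 (n choose_) j * u ^ j * v ^ l + (n choose j) * u ^ j * v ^ l
      ≤⟨ +-mono-≤ (shift-row-≤ R≤ 1 0 j l eq) (shift-row-≤ R≤ 0 1 j l eq) ⟩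
    u ^ 1 * v ^ 0 * shift 1 (λ j′ → R j′ l) j + u ^ 0 * v ^ 1 * shift 1 (R j) l
      ≡⟨ units u v (shift 1 (λ j′ → R j′ l) j) (shift 1 (R j) l) ⟩
    u * shift 1 (λ j′ → R j′ l) j + v * shift 1 (R j) l ∎
    where
    distrib : ∀ x y p q → (x + y) * p * q ≡ x * p * q + y * p * q
    distrib = solve-∀
    units : ∀ u v x y → u * 1 * 1 * x + 1 * (v * 1) * y ≡ u * x + v * y
    units = solve-∀

  pascal-row² : ∀ {n R} → Row≤ n R → Row≤ (suc (suc n)) (λ j l →
      u * u * shift 2 (λ j′ → R j′ l) j + u * v * shift 1 (λ j′ → shift 1 (R j′) l) j
    + (u * v * shift 1 (λ j′ → shift 1 (R j′) l) j + v * v * shift 2 (R j) l))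
  pascal-row² {n} {R} R≤ j l eq = begin
    (suc (suc n) choose j) * u ^ j * v ^ l
      ≡⟨ cong (λ x → x * u ^ j * v ^ l) (pascal² n j) ⟩
    (shift 2 (n choose_) j + shift 1 (n choose_) j + (shift 1 (n choose_) j + (n choose j))) * u ^ j * v ^ l
      ≡⟨ distrib (shift 2 (n choose_) j) (shift 1 (n choose_) j) (n choose j) (u ^ j) (v ^ l) ⟩
    shift 2 (n choose_) j * u ^ j * v ^ l + shift 1 (n choose_) j * u ^ j * v ^ l
    + (shift 1 (n choose_) j * u ^ j * v ^ l + (n choose j) * u ^ j * v ^ l)
      ≤⟨ +-mono-≤ (+-mono-≤ (shift-row-≤ R≤ 2 0 j l eq) (shift-row-≤ R≤ 1 1 j l eq))
                  (+-mono-≤ (shift-row-≤ R≤ 1 1 j l eq) (shift-row-≤ R≤ 0 2 j l eq)) ⟩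
    u ^ 2 * v ^ 0 * S₂₀ + u ^ 1 * v ^ 1 * S₁₁ + (u ^ 1 * v ^ 1 * S₁₁ + u ^ 0 * v ^ 2 * S₀₂)
      ≡⟨ units u v S₂₀ S₁₁ S₀₂ ⟩
    u * u * S₂₀ + u * v * S₁₁ + (u * v * S₁₁ + v * v * S₀₂) ∎
    where
    S₂₀ = shift 2 (λ j′ → R j′ l) j
    S₁₁ = shift 1 (λ j′ → shift 1 (R j′) l) j
    S₀₂ = shift 2 (R j) l
    distrib : ∀ x y z p q → (x + y + (y + z)) * p * q ≡ x * p * q + y * p * q + (y * p * q + z * p * q)
    distrib = solve-∀
    units : ∀ u v x y z → u * (u * 1) * 1 * x + u * 1 * (v * 1) * y + (u * 1 * (v * 1) * y + 1 * (v * (v * 1)) * z)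
                         ≡ u * u * x + u * v * y + (u * v * y + v * v * z)
    units = solve-∀

module _ (P Q : Poly) (e e′ : ℕ) where
  open Row (P 0 e 0) (Q 0 0 e′)

  ⊕-pow-coeffʸᶻ : ∀ m → Row≤ m (λ j l → ((P ⊕ Q) ^ᴾ m) 0 (j * e) (l * e′))
  ⊕-pow-coeffʸᶻ zero    zero    zero    refl = ≤-refl
  ⊕-pow-coeffʸᶻ (suc m) = Row≤-mono (pascal-row (⊕-pow-coeffʸᶻ m)) λ j l → begin
    P 0 e 0 * shift 1 (λ j′ → F 0 (j′ * e) (l * e′)) j
    + Q 0 0 e′ * shift 1 (λ l′ → F 0 (j * e) (l′ * e′)) l
      ≤⟨ +-mono-≤ (*-shift-≤ (P 0 e 0) 1 (λ j′ → F 0 (j′ * e) (l * e′)) j {(P ⊗ F) 0 (j * e) (l * e′)}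
                    λ { j′ refl → *≤⊗ P F 0 e 0 0 (j′ * e) (l * e′) })
                  (*-shift-≤ (Q 0 0 e′) 1 (λ l′ → F 0 (j * e) (l′ * e′)) l {(Q ⊗ F) 0 (j * e) (l * e′)}
                    λ { l′ refl → *≤⊗ Q F 0 0 e′ 0 (j * e) (l′ * e′) }) ⟩
    (P ⊗ F) 0 (j * e) (l * e′) + (Q ⊗ F) 0 (j * e) (l * e′)
      ≡⟨ ⊗-distribʳ-⊕ P Q F 0 (j * e) (l * e′) ⟨
    ((P ⊕ Q) ⊗ F) 0 (j * e) (l * e′) ∎
    where F = (P ⊕ Q) ^ᴾ m

module _ (P Q : Poly) where
  open Row (P 0 1 0) (Q 0 0 1)

  sq-⊕-pow-coeff : ∀ h → Row≤ (h * 2) (λ j l → (sq (P ⊕ Q) ^ᴾ h) 0 j l)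
  sq-⊕-pow-coeff zero    zero    zero    refl = ≤-refl
  sq-⊕-pow-coeff (suc h) = Row≤-mono (pascal-row² (sq-⊕-pow-coeff h)) λ j l → begin
    u * u * shift 2 (λ j′ → F 0 j′ l) j + u * v * S₁₁ j l + (u * v * S₁₁ j l + v * v * shift 2 (F 0 j) l)
      ≤⟨ +-mono-≤ (+-mono-≤ (⊗-shift-≤ (P ⊗ P) F 2 0 j l (*≤⊗ P P 0 1 0 0 1 0))
                            (⊗-shift-≤ (P ⊗ Q) F 1 1 j l (*≤⊗ P Q 0 1 0 0 0 1)))
                  (+-mono-≤ (⊗-shift-≤ (Q ⊗ P) F 1 1 j l (≤-trans (≤-reflexive (*-comm u v))
                                                                  (*≤⊗ Q P 0 0 1 0 1 0)))
                            (⊗-shift-≤ (Q ⊗ Q) F 0 2 j l (*≤⊗ Q Q 0 0 1 0 0 1))) ⟩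
    ((P ⊗ P) ⊗ F) 0 j l + ((P ⊗ Q) ⊗ F) 0 j l + (((Q ⊗ P) ⊗ F) 0 j l + ((Q ⊗ Q) ⊗ F) 0 j l)
      ≡⟨ cong₂ _+_ (⊗-distribʳ-⊕ (P ⊗ P) (P ⊗ Q) F 0 j l) (⊗-distribʳ-⊕ (Q ⊗ P) (Q ⊗ Q) F 0 j l) ⟨
    ((P ⊗ P ⊕ P ⊗ Q) ⊗ F) 0 j l + ((Q ⊗ P ⊕ Q ⊗ Q) ⊗ F) 0 j l
      ≡⟨ ⊗-distribʳ-⊕ (P ⊗ P ⊕ P ⊗ Q) (Q ⊗ P ⊕ Q ⊗ Q) F 0 j l ⟨
    (((P ⊗ P ⊕ P ⊗ Q) ⊕ (Q ⊗ P ⊕ Q ⊗ Q)) ⊗ F) 0 j l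
      ≤⟨ ⊗-monoˡ-≤ F (sq-⊕-≥ P Q) 0 j l ⟩
    (sq (P ⊕ Q) ⊗ F) 0 j l ∎
    where
    u = P 0 1 0
    v = Q 0 0 1
    F = sq (P ⊕ Q) ^ᴾ h
    S₁₁ : ℕ → ℕ → ℕ
    S₁₁ j l = shift 1 (λ j′ → shift 1 (F 0 j′) l) j

-- Pascal's rule: a factor f of f ^ᴾ suc m either contributes x^e through P, raising i,
-- or an x-free term through G, raising k.
module _ {f P G : Poly} (P⊕G≤f : P ⊕ G ≤ᴾ f) (e : ℕ) where

  ⊕-pow-coeffˣ : ∀ m i k → i + k ≡ m → ∀ b c →
                 (m choose i) * P e 0 0 ^ i * (G ^ᴾ k) 0 b c ≤ (f ^ᴾ m) (i * e) b c
  ⊕-pow-coeffˣ zero    zero zero refl b c = ≤-reflexive (*-identityˡ _)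
  ⊕-pow-coeffˣ (suc m) i    k    eq   b c = begin
    (suc m choose i) * u ^ i * W
      ≡⟨ cong (λ x → x * u ^ i * W) (pascal m i) ⟩
    (shift 1 (m choose_) i + (m choose i)) * u ^ i * W
      ≡⟨ distrib (shift 1 (m choose_) i) (m choose i) (u ^ i) W ⟩
    shift 1 (m choose_) i * u ^ i * W + (m choose i) * u ^ i * W
      ≤⟨ +-mono-≤ (through-P i eq) (through-G k eq) ⟩
    (P ⊗ F) (i * e) b c + (G ⊗ F) (i * e) b c
      ≡⟨ ⊗-distribʳ-⊕ P G F (i * e) b c ⟨
    ((P ⊕ G) ⊗ F) (i * e) b c
      ≤⟨ ⊗-monoˡ-≤ F P⊕G≤f (i * e) b c ⟩
    (f ⊗ F) (i * e) b c ∎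
    where
    u = P e 0 0
    W = (G ^ᴾ k) 0 b c
    F = f ^ᴾ m
    distrib : ∀ x y p q → (x + y) * p * q ≡ x * p * q + y * p * q
    distrib = solve-∀
    through-P : ∀ i → i + k ≡ suc m → shift 1 (m choose_) i * u ^ i * W ≤ (P ⊗ F) (i * e) b c
    through-P zero    _  = z≤n
    through-P (suc i) eq = begin
      (m choose i) * (u * u ^ i) * W  ≡⟨ pull u (m choose i) (u ^ i) W ⟩
      u * ((m choose i) * u ^ i * W)  ≤⟨ *-monoʳ-≤ u (⊕-pow-coeffˣ m i k (suc-injective eq) b c) ⟩
      u * F (i * e) b c               ≤⟨ *≤⊗ P F e 0 0 (i * e) b c ⟩
      (P ⊗ F) (e + i * e) b c         ∎
      where
      pull : ∀ u x y z → x * (u * y) * z ≡ u * (x * y * z)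
      pull = solve-∀
    through-G : ∀ k → i + k ≡ suc m → (m choose i) * u ^ i * (G ^ᴾ k) 0 b c ≤ (G ⊗ F) (i * e) b c
    through-G zero    eq = begin
      (m choose i) * u ^ i * one 0 b c  ≡⟨ cong (λ x → x * u ^ i * one 0 b c) (k>n⇒nCk≡0 i>m) ⟩
      0                                 ≤⟨ z≤n ⟩
      (G ⊗ F) (i * e) b c               ∎
      where
      i>m : i > m
      i>m = ≤-reflexive (sym (trans (sym (+-identityʳ i)) eq))
    through-G (suc k) eq = x⁰-⊗-≤ G F (G ^ᴾ k) ((m choose i) * u ^ i) (i * e) b c
      (⊕-pow-coeffˣ m i k (suc-injective (trans (sym (+-suc i k)) eq)))

-- The largest term of a binomial expansion

binomial-term : ℕ → ℕ → ℕ → ℕ → ℕ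
binomial-term u w n j = (n choose j) * (u ^ j * w ^ (n ∸ j))

binomial-theorem : ∀ u w n → (u + w) ^ n ≡ sum {suc n} (λ j → binomial-term u w n (toℕ j))
binomial-theorem u w n = begin-equality
  (u + w) ^ n   ≡⟨ ^′≡^ (u + w) n ⟨
  (u + w) ^′ n  ≡⟨ semiring-binomial-theorem n u w ⟩
  sum {suc n} (λ j → (n choose toℕ j) ×′ (u ^′ toℕ j * w ^′ (n ∸ toℕ j)))
    ≡⟨ sum-cong-≗ {suc n} (λ j → trans (×′≡* (n choose toℕ j) _)
                                       (cong₂ (λ x y → (n choose toℕ j) * (x * y))
                                              (^′≡^ u (toℕ j)) (^′≡^ w (n ∸ toℕ j)))) ⟩
  sum {suc n} (λ j → binomial-term u w n (toℕ j)) ∎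
  where
  ^′≡^ : ∀ x n → x ^′ n ≡ x ^ n
  ^′≡^ x zero    = refl
  ^′≡^ x (suc n) = cong (x *_) (^′≡^ x n)
  ×′≡* : ∀ m x → m ×′ x ≡ m * x
  ×′≡* zero    x = refl
  ×′≡* (suc m) x = cong (x +_) (×′≡* m x)

sum-≤ : ∀ {n} (f : Fin n → ℕ) {c} → (∀ i → f i ≤ c) → sum f ≤ n * c
sum-≤ {zero}  f f≤c = z≤n
sum-≤ {suc n} f f≤c = +-mono-≤ (f≤c Fin.zero) (sum-≤ (λ i → f (Fin.suc i)) (λ i → f≤c (Fin.suc i)))

binomial-term-ratio : ∀ u w n j → j < n →
  binomial-term u w n (suc j) * (suc j * w) ≡ binomial-term u w n j * ((n ∸ j) * u)
binomial-term-ratio u w n j j<n = begin-equality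
  (n choose suc j) * (u * u ^ j * w ^ (n ∸ suc j)) * (suc j * w)
    ≡⟨ regroup (n choose suc j) (suc j) u (u ^ j) w (w ^ (n ∸ suc j)) ⟩
  (n choose suc j) * suc j * (u ^ j * (w * w ^ (n ∸ suc j))) * u
    ≡⟨ cong₂ (λ x y → x * (u ^ j * w ^ y) * u) (nC[1+k]*[1+k]≡nCk*[n∸k] n j) (sym (+-∸-assoc 1 j<n)) ⟩
  (n choose j) * (n ∸ j) * (u ^ j * w ^ (n ∸ j)) * u
    ≡⟨ regroup′ (n choose j) (n ∸ j) (u ^ j * w ^ (n ∸ j)) u ⟩
  (n choose j) * (u ^ j * w ^ (n ∸ j)) * ((n ∸ j) * u) ∎
  where
  regroup : ∀ c s u U w W → c * (u * U * W) * (s * w) ≡ c * s * (U * (w * W)) * u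
  regroup = solve-∀
  regroup′ : ∀ c d x u → c * d * x * u ≡ c * x * (d * u)
  regroup′ = solve-∀

mode-max : ∀ (t : ℕ → ℕ) k →
           (∀ j → suc j ≤ k → t j ≤ t (suc j)) → (∀ j → k ≤ j → t (suc j) ≤ t j) → ∀ j → t j ≤ t k
mode-max t k up down j with ≤-total j k
... | inj₁ j≤k = climb (k ∸ j) j (m+[n∸m]≡n j≤k)
  where
  climb : ∀ d j → j + d ≡ k → t j ≤ t k
  climb zero    j eq = ≤-reflexive (cong t (trans (sym (+-identityʳ j)) eq))
  climb (suc d) j eq = ≤-trans (up j (≤-trans (s≤s (m≤m+n j d)) (≤-reflexive eq′))) (climb d (suc j) eq′)
    where eq′ = trans (sym (+-suc j d)) eq
... | inj₂ k≤j = subst (λ i → t i ≤ t k) (m∸n+n≡m k≤j) (descend (j ∸ k))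
  where
  descend : ∀ d → t (d + k) ≤ t k
  descend zero    = ≤-refl
  descend (suc d) = ≤-trans (down (d + k) (m≤n+m k d)) (descend d)

module _ {u w k l} (0<u : 0 < u) (0<w : 0 < w) (kw≡lu : k * w ≡ l * u) where

  private
    M = k + l
    t = binomial-term u w M

  binomial-term-rising : ∀ j → suc j ≤ k → t j ≤ t (suc j)
  binomial-term-rising j j<k =
    *-cancelʳ-≤ (t j) (t (suc j)) ((M ∸ j) * u) {{>-nonZero (*-mono-≤ (m<n⇒0<n∸m j<M) 0<u)}} (begin
      t j * ((M ∸ j) * u)        ≡⟨ binomial-term-ratio u w M j j<M ⟨
      t (suc j) * (suc j * w)    ≤⟨ *-monoʳ-≤ (t (suc j)) ratio≤1 ⟩
      t (suc j) * ((M ∸ j) * u)  ∎)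
    where
    j<M = ≤-trans j<k (m≤m+n k l)
    ratio≤1 : suc j * w ≤ (M ∸ j) * u
    ratio≤1 = +-cancelʳ-≤ (j * u) _ _ (begin
      suc j * w + j * u    ≤⟨ +-mono-≤ (*-monoˡ-≤ w j<k) (*-monoˡ-≤ u (<⇒≤ j<k)) ⟩
      k * w + k * u        ≡⟨ cong (_+ k * u) kw≡lu ⟩
      l * u + k * u        ≡⟨ trans (*-distribʳ-+ u k l) (+-comm (k * u) (l * u)) ⟨
      M * u                ≡⟨ cong (_* u) (m∸n+n≡m (<⇒≤ j<M)) ⟨
      (M ∸ j + j) * u      ≡⟨ *-distribʳ-+ u (M ∸ j) j ⟩
      (M ∸ j) * u + j * u  ∎)

  binomial-term-falling : ∀ j → k ≤ j → t (suc j) ≤ t j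
  binomial-term-falling j k≤j with j <? M
  ... | no j≮M =
    ≤-trans (≤-reflexive (cong (_* (u ^ suc j * w ^ (M ∸ suc j))) (k>n⇒nCk≡0 (s≤s (≮⇒≥ j≮M))))) z≤n
  ... | yes j<M =
    *-cancelʳ-≤ (t (suc j)) (t j) (suc j * w) {{>-nonZero (*-mono-≤ (s≤s (z≤n {j})) 0<w)}} (begin
      t (suc j) * (suc j * w)    ≡⟨ binomial-term-ratio u w M j j<M ⟩
      t j * ((M ∸ j) * u)        ≤⟨ *-monoʳ-≤ (t j) ratio≥1 ⟩
      t j * (suc j * w)          ∎)
    where
    ratio≥1 : (M ∸ j) * u ≤ suc j * w
    ratio≥1 = +-cancelʳ-≤ (j * u) _ _ (begin
      (M ∸ j) * u + j * u  ≡⟨ *-distribʳ-+ u (M ∸ j) j ⟨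
      (M ∸ j + j) * u      ≡⟨ cong (_* u) (m∸n+n≡m (<⇒≤ j<M)) ⟩
      M * u                ≡⟨ *-distribʳ-+ u k l ⟩
      k * u + l * u        ≡⟨ cong (k * u +_) kw≡lu ⟨
      k * u + k * w        ≤⟨ +-mono-≤ (*-monoˡ-≤ u k≤j) (*-monoˡ-≤ w (m≤n⇒m≤1+n k≤j)) ⟩
      j * u + suc j * w    ≡⟨ +-comm (j * u) (suc j * w) ⟩
      suc j * w + j * u    ∎)

  central-term : ∀ {N} → k + l ≡ N → (u + w) ^ N ≤ suc N * ((N choose k) * (u ^ k * w ^ l))
  central-term refl = begin
    (u + w) ^ M
      ≡⟨ binomial-theorem u w M ⟩
    sum {suc M} (λ j → t (toℕ j))
      ≤⟨ sum-≤ {suc M} (λ j → t (toℕ j)) (λ j → t≤tk (toℕ j)) ⟩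
    suc M * t k
      ≡⟨ cong (λ x → suc M * ((M choose k) * (u ^ k * w ^ x))) (m+n∸m≡n k l) ⟩
    suc M * ((M choose k) * (u ^ k * w ^ l))  ∎
    where
    t≤tk = mode-max t k binomial-term-rising binomial-term-falling

-- x^(2 xA) y^(2 yA) z^(2 zA) in (x² + 2y² + z²)^A; x^(2 xB) y^yB z^zB in (x² + (y + z)²)^B,
-- with (y + z)² taken hB times; and y^yC z^zC in ((2y + z)²)^C.
record Split (A B C p q r : ℕ) : Set where
  field
    xA yA zA xB yB zB hB yC zC : ℕ
    A-split  : xA + (yA + zA) ≡ A
    B-split  : xB + hB ≡ B
    hB-split : yB + zB ≡ hB * 2
    C-split  : yC + zC ≡ C * 2
    p-split  : xA * 2 + xB * 2 ≡ p
    q-split  : yA * 2 + yB + yC ≡ q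
    r-split  : zA * 2 + zB + zC ≡ r

weight : ∀ {A B C p q r} → Split A B C p q r → ℕ
weight {A} {B} {C} s =
  (A choose xA) * (((yA + zA) choose yA) * 2 ^ yA) * ((B choose xB) * ((hB * 2) choose yB))
  * (((C * 2) choose yC) * 2 ^ yC)
  where open Split s

coefficientA : ∀ {A} xA yA zA → xA + (yA + zA) ≡ A →
  (A choose xA) * (((yA + zA) choose yA) * 2 ^ yA) ≤ ((sq X ⊕ 2 ⊙ sq Y ⊕ sq Z) ^ᴾ A) (xA * 2) (yA * 2) (zA * 2)
coefficientA {A} xA yA zA eq = begin
  (A choose xA) * (c * 2 ^ yA)
    ≡⟨ units (A choose xA) (c * 2 ^ yA) ⟩
  (A choose xA) * 1 * (c * 2 ^ yA * 1)
    ≡⟨ cong₂ (λ x y → (A choose xA) * x * (c * 2 ^ yA * y)) (^-zeroˡ xA) (^-zeroˡ zA) ⟨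
  (A choose xA) * 1 ^ xA * (c * 2 ^ yA * 1 ^ zA)
    ≤⟨ *-monoʳ-≤ ((A choose xA) * 1 ^ xA) (⊕-pow-coeffʸᶻ (2 ⊙ sq Y) (sq Z) 2 2 (yA + zA) yA zA refl) ⟩
  (A choose xA) * 1 ^ xA * ((2 ⊙ sq Y ⊕ sq Z) ^ᴾ (yA + zA)) 0 (yA * 2) (zA * 2)
    ≤⟨ ⊕-pow-coeffˣ {sq X ⊕ 2 ⊙ sq Y ⊕ sq Z} {sq X} {2 ⊙ sq Y ⊕ sq Z} reassociate 2 A xA (yA + zA) eq
                    (yA * 2) (zA * 2) ⟩
  ((sq X ⊕ 2 ⊙ sq Y ⊕ sq Z) ^ᴾ A) (xA * 2) (yA * 2) (zA * 2) ∎
  where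
  c = (yA + zA) choose yA
  reassociate : sq X ⊕ (2 ⊙ sq Y ⊕ sq Z) ≤ᴾ sq X ⊕ 2 ⊙ sq Y ⊕ sq Z
  reassociate a b c = ≤-reflexive (sym (+-assoc (sq X a b c) ((2 ⊙ sq Y) a b c) (sq Z a b c)))
  units : ∀ x y → x * y ≡ x * 1 * (y * 1)
  units = solve-∀

coefficientB : ∀ {B} xB hB yB zB → xB + hB ≡ B → yB + zB ≡ hB * 2 →
  (B choose xB) * ((hB * 2) choose yB) ≤ ((sq X ⊕ sq (Y ⊕ Z)) ^ᴾ B) (xB * 2) yB zB
coefficientB {B} xB hB yB zB eq eq′ = begin
  (B choose xB) * c
    ≡⟨ units (B choose xB) c ⟩
  (B choose xB) * 1 * (c * 1 * 1)
    ≡⟨ cong₂ (λ x y → (B choose xB) * x * y) (^-zeroˡ xB)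
             (cong₂ (λ y z → c * y * z) (^-zeroˡ yB) (^-zeroˡ zB)) ⟨
  (B choose xB) * 1 ^ xB * (c * 1 ^ yB * 1 ^ zB)
    ≤⟨ *-monoʳ-≤ ((B choose xB) * 1 ^ xB) (sq-⊕-pow-coeff Y Z hB yB zB eq′) ⟩
  (B choose xB) * 1 ^ xB * (sq (Y ⊕ Z) ^ᴾ hB) 0 yB zB
    ≤⟨ ⊕-pow-coeffˣ {sq X ⊕ sq (Y ⊕ Z)} {sq X} {sq (Y ⊕ Z)} (λ a b c → ≤-refl) 2 B xB hB eq yB zB ⟩
  ((sq X ⊕ sq (Y ⊕ Z)) ^ᴾ B) (xB * 2) yB zB ∎
  where
  c = (hB * 2) choose yB
  units : ∀ x y → x * y ≡ x * 1 * (y * 1 * 1)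
  units = solve-∀

coefficientC : ∀ {C} yC zC → yC + zC ≡ C * 2 →
  ((C * 2) choose yC) * 2 ^ yC ≤ (sq (2 ⊙ Y ⊕ Z) ^ᴾ C) 0 yC zC
coefficientC {C} yC zC eq = begin
  ((C * 2) choose yC) * 2 ^ yC          ≡⟨ *-identityʳ _ ⟨
  ((C * 2) choose yC) * 2 ^ yC * 1      ≡⟨ cong (((C * 2) choose yC) * 2 ^ yC *_) (^-zeroˡ zC) ⟨
  ((C * 2) choose yC) * 2 ^ yC * 1 ^ zC ≤⟨ sq-⊕-pow-coeff (2 ⊙ Y) Z C yC zC eq ⟩
  (sq (2 ⊙ Y ⊕ Z) ^ᴾ C) 0 yC zC         ∎

coefficient-bound : ∀ {A B C p q r} (s : Split A B C p q r) → weight s ≤ P A B C p q r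
coefficient-bound {A} {B} {C} s@record { p-split = refl ; q-split = refl ; r-split = refl } = begin
  weight s
    ≤⟨ *-mono-≤ (*-mono-≤ (coefficientA xA yA zA A-split) (coefficientB xB hB yB zB B-split hB-split))
                (coefficientC {C} yC zC C-split) ⟩
  FA (xA * 2) (yA * 2) (zA * 2) * FB (xB * 2) yB zB * FC 0 yC zC
    ≤⟨ *-monoˡ-≤ (FC 0 yC zC) (*≤⊗ FA FB (xA * 2) (yA * 2) (zA * 2) (xB * 2) yB zB) ⟩
  (FA ⊗ FB) (xA * 2 + xB * 2) (yA * 2 + yB) (zA * 2 + zB) * FC 0 yC zC
    ≤⟨ *≤⊗ (FA ⊗ FB) FC (xA * 2 + xB * 2) (yA * 2 + yB) (zA * 2 + zB) 0 yC zC ⟩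
  P A B C (xA * 2 + xB * 2 + 0) (yA * 2 + yB + yC) (zA * 2 + zB + zC)
    ≡⟨ cong (λ p → P A B C p (yA * 2 + yB + yC) (zA * 2 + zB + zC)) (+-identityʳ (xA * 2 + xB * 2)) ⟩
  P A B C (xA * 2 + xB * 2) (yA * 2 + yB + yC) (zA * 2 + zB + zC) ∎
  where
  open Split s
  FA = (sq X ⊕ 2 ⊙ sq Y ⊕ sq Z) ^ᴾ A
  FB = (sq X ⊕ sq (Y ⊕ Z)) ^ᴾ B
  FC = sq (2 ⊙ Y ⊕ Z) ^ᴾ C

split : ∀ xA yA zA xB hB yB zB C yC zC → yB + zB ≡ hB * 2 → yC + zC ≡ C * 2 →
        Split (xA + (yA + zA)) (xB + hB) C (xA * 2 + xB * 2) (yA * 2 + yB + yC) (zA * 2 + zB + zC)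
split xA yA zA xB hB yB zB C yC zC hB-split C-split = record
  { xA = xA ; yA = yA ; zA = zA ; xB = xB ; yB = yB ; zB = zB ; hB = hB ; yC = yC ; zC = zC
  ; A-split = refl ; B-split = refl ; hB-split = hB-split ; C-split = C-split
  ; p-split = refl ; q-split = refl ; r-split = refl }

infixl 6 _+ˢ_

_+ˢ_ : ∀ {A B C p q r A′ B′ C′ p′ q′ r′} → Split A B C p q r → Split A′ B′ C′ p′ q′ r′ →
       Split (A + A′) (B + B′) (C + C′) (p + p′) (q + q′) (r + r′)
_+ˢ_ {C = C} {C′ = C′} s s′ = record
  { xA = xA s + xA s′ ; yA = yA s + yA s′ ; zA = zA s + zA s′
  ; xB = xB s + xB s′ ; yB = yB s + yB s′ ; zB = zB s + zB s′ ; hB = hB s + hB s′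
  ; yC = yC s + yC s′ ; zC = zC s + zC s′
  ; A-split  = trans (regroupA (xA s) (yA s) (zA s) (xA s′) (yA s′) (zA s′)) (cong₂ _+_ (A-split s) (A-split s′))
  ; B-split  = trans (+-interchange (xB s) (xB s′) (hB s) (hB s′)) (cong₂ _+_ (B-split s) (B-split s′))
  ; hB-split = trans (+-interchange (yB s) (yB s′) (zB s) (zB s′))
                    (trans (cong₂ _+_ (hB-split s) (hB-split s′)) (sym (*-distribʳ-+ 2 (hB s) (hB s′))))
  ; C-split  = trans (+-interchange (yC s) (yC s′) (zC s) (zC s′))
                    (trans (cong₂ _+_ (C-split s) (C-split s′)) (sym (*-distribʳ-+ 2 C C′)))
  ; p-split  = trans (regroupp (xA s) (xB s) (xA s′) (xB s′)) (cong₂ _+_ (p-split s) (p-split s′))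
  ; q-split  = trans (regroupq (yA s) (yB s) (yC s) (yA s′) (yB s′) (yC s′)) (cong₂ _+_ (q-split s) (q-split s′))
  ; r-split  = trans (regroupq (zA s) (zB s) (zC s) (zA s′) (zB s′) (zC s′)) (cong₂ _+_ (r-split s) (r-split s′))
  }
  where
  open Split
  regroupA : ∀ a b c a′ b′ c′ → a + a′ + (b + b′ + (c + c′)) ≡ a + (b + c) + (a′ + (b′ + c′))
  regroupA = solve-∀
  regroupp : ∀ a b a′ b′ → (a + a′) * 2 + (b + b′) * 2 ≡ a * 2 + b * 2 + (a′ * 2 + b′ * 2)
  regroupp = solve-∀
  regroupq : ∀ a b c a′ b′ c′ → (a + a′) * 2 + (b + b′) + (c + c′) ≡ a * 2 + b + c + (a′ * 2 + b′ + c′)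
  regroupq = solve-∀

weight-≤-+ˢ : ∀ {A B C p q r A′ B′ C′ p′ q′ r′}
              (s : Split A B C p q r) (s′ : Split A′ B′ C′ p′ q′ r′) → weight s′ ≤ weight (s +ˢ s′)
weight-≤-+ˢ {A} {B} {C} {A′ = A′} {B′} {C′} s s′ =
  *-mono-≤ (*-mono-≤ (*-mono-≤ A-mono (*-mono-≤ yzA-mono (^-monoʳ-≤ 2 (m≤n+m (yA s′) (yA s)))))
                     (*-mono-≤ B-mono hB-mono))
           (*-mono-≤ C-mono (^-monoʳ-≤ 2 (m≤n+m (yC s′) (yC s))))
  where
  open Split
  A-mono : A′ choose xA s′ ≤ (A + A′) choose (xA s + xA s′)
  A-mono = m′Ci′≤[m+m′]C[i+i′] A A′ (xA s) (xA s′) (m+n≤o⇒m≤o _ (≤-reflexive (A-split s)))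
  yzA-mono : (yA s′ + zA s′) choose yA s′ ≤ (yA s + yA s′ + (zA s + zA s′)) choose (yA s + yA s′)
  yzA-mono = ≤-trans (m′Ci′≤[m+m′]C[i+i′] (yA s + zA s) (yA s′ + zA s′) (yA s) (yA s′) (m≤m+n _ _))
                     (≤-reflexive (cong (_choose (yA s + yA s′)) (+-interchange (yA s) (zA s) (yA s′) (zA s′))))
  B-mono : B′ choose xB s′ ≤ (B + B′) choose (xB s + xB s′)
  B-mono = m′Ci′≤[m+m′]C[i+i′] B B′ (xB s) (xB s′) (m+n≤o⇒m≤o _ (≤-reflexive (B-split s)))
  hB-mono : (hB s′ * 2) choose yB s′ ≤ ((hB s + hB s′) * 2) choose (yB s + yB s′)
  hB-mono = ≤-trans (m′Ci′≤[m+m′]C[i+i′] (hB s * 2) (hB s′ * 2) (yB s) (yB s′)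
                                           (m+n≤o⇒m≤o _ (≤-reflexive (hB-split s))))
                    (≤-reflexive (cong (_choose (yB s + yB s′)) (sym (*-distribʳ-+ 2 (hB s) (hB s′)))))
  C-mono : (C′ * 2) choose yC s′ ≤ ((C + C′) * 2) choose (yC s + yC s′)
  C-mono = ≤-trans (m′Ci′≤[m+m′]C[i+i′] (C * 2) (C′ * 2) (yC s) (yC s′)
                                          (m+n≤o⇒m≤o _ (≤-reflexive (C-split s))))
                   (≤-reflexive (cong (_choose (yC s + yC s′)) (sym (*-distribʳ-+ 2 C C′))))

proportional : ∀ α β γ →
  Split (α * 25) (β * 25) (γ * 5) (α * 32 + β * 32) (α * 16 + β * 12 + γ * 8) (α * 2 + β * 6 + γ * 2)
proportional α β γ = record
  { xA = α * 16 ; yA = α * 8 ; zA = α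
  ; xB = β * 16 ; yB = β * 12 ; zB = β * 6 ; hB = β * 9
  ; yC = γ * 8 ; zC = γ * 2
  ; A-split  = solve (α ∷ [])
  ; B-split  = solve (β ∷ [])
  ; hB-split = solve (β ∷ [])
  ; C-split  = solve (γ ∷ [])
  ; p-split  = solve (α ∷ β ∷ [])
  ; q-split  = solve (α ∷ β ∷ γ ∷ [])
  ; r-split  = solve (α ∷ β ∷ γ ∷ [])
  }

^-regroup : ∀ m {a b c d} → a + b ≡ c + d → m ^ a * m ^ b ≡ m ^ c * m ^ d
^-regroup m {a} {b} {c} {d} eq =
  trans (sym (^-distribˡ-+-* m a b)) (trans (cong (m ^_) eq) (^-distribˡ-+-* m c d))

blockA : ∀ α → let M = α * 25; M′ = α * 8 + α in
  5 ^ (α * 50) ≤ suc M * suc M′ * ((M choose (α * 16)) * ((M′ choose (α * 8)) * 2 ^ (α * 8)) * 2 ^ (α * 80))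
blockA α = begin
  5 ^ (α * 50)
    ≡⟨ trans (cong (5 ^_) (exponent α)) (sym (^-*-assoc 5 2 M)) ⟩
  (16 + 9) ^ M
    ≤⟨ central-term {16} {9} {α * 16} {M′} (s≤s z≤n) (s≤s z≤n) (ratio α) (parts α) ⟩
  suc M * (c₁ * (16 ^ (α * 16) * (8 + 1) ^ M′))
    ≤⟨ *-monoʳ-≤ (suc M) (*-monoʳ-≤ c₁ (*-monoʳ-≤ (16 ^ (α * 16))
         (central-term {8} {1} {α * 8} {α} (s≤s z≤n) (s≤s z≤n) (*-identityʳ (α * 8)) refl))) ⟩
  suc M * (c₁ * (16 ^ (α * 16) * (suc M′ * (c₂ * (8 ^ (α * 8) * 1 ^ α)))))
    ≡⟨ cong (λ x → suc M * (c₁ * (16 ^ (α * 16) * (suc M′ * (c₂ * (8 ^ (α * 8) * x)))))) (^-zeroˡ α) ⟩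
  suc M * (c₁ * (16 ^ (α * 16) * (suc M′ * (c₂ * (8 ^ (α * 8) * 1)))))
    ≡⟨ regroup (suc M) (suc M′) c₁ c₂ (16 ^ (α * 16)) (8 ^ (α * 8)) ⟩
  suc M * suc M′ * (c₁ * (c₂ * (16 ^ (α * 16) * 8 ^ (α * 8))))
    ≡⟨ cong (λ x → suc M * suc M′ * (c₁ * (c₂ * x)))
            (trans (cong₂ _*_ (^-*-assoc 2 4 (α * 16)) (^-*-assoc 2 3 (α * 8)))
                   (^-regroup 2 {4 * (α * 16)} {3 * (α * 8)} {α * 8} {α * 80} (exponent′ α))) ⟩
  suc M * suc M′ * (c₁ * (c₂ * (2 ^ (α * 8) * 2 ^ (α * 80))))
    ≡⟨ cong (suc M * suc M′ *_) (regroup′ c₁ c₂ (2 ^ (α * 8)) (2 ^ (α * 80))) ⟩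
  suc M * suc M′ * (c₁ * (c₂ * 2 ^ (α * 8)) * 2 ^ (α * 80)) ∎
  where
  M = α * 25
  M′ = α * 8 + α
  c₁ = M choose (α * 16)
  c₂ = M′ choose (α * 8)
  exponent : ∀ α → α * 50 ≡ 2 * (α * 25)
  exponent = solve-∀
  parts : ∀ α → α * 16 + (α * 8 + α) ≡ α * 25
  parts = solve-∀
  ratio : ∀ α → α * 16 * 9 ≡ (α * 8 + α) * 16
  ratio = solve-∀
  exponent′ : ∀ α → 4 * (α * 16) + 3 * (α * 8) ≡ α * 8 + α * 80
  exponent′ = solve-∀
  regroup : ∀ s s′ c₁ c₂ x y → s * (c₁ * (x * (s′ * (c₂ * (y * 1))))) ≡ s * s′ * (c₁ * (c₂ * (x * y)))
  regroup = solve-∀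
  regroup′ : ∀ c₁ c₂ x y → c₁ * (c₂ * (x * y)) ≡ c₁ * (c₂ * x) * y
  regroup′ = solve-∀

blockB : ∀ β → let M = β * 25; M′ = β * 9 * 2 in
  5 ^ (β * 50) ≤ suc M * suc M′ * ((M choose (β * 16)) * (M′ choose (β * 12)) * 2 ^ (β * 76))
blockB β = begin
  5 ^ (β * 50)
    ≡⟨ trans (cong (5 ^_) (exponent β)) (sym (^-*-assoc 5 2 M)) ⟩
  (16 + 9) ^ M
    ≤⟨ central-term {16} {9} {β * 16} {β * 9} (s≤s z≤n) (s≤s z≤n) (ratio β) (parts β) ⟩
  suc M * (c₁ * (16 ^ (β * 16) * 9 ^ (β * 9)))
    ≡⟨ cong (λ x → suc M * (c₁ * (16 ^ (β * 16) * x)))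
            (trans (^-*-assoc 3 2 (β * 9)) (cong (3 ^_) (*-comm 2 (β * 9)))) ⟩
  suc M * (c₁ * (16 ^ (β * 16) * (2 + 1) ^ M′))
    ≤⟨ *-monoʳ-≤ (suc M) (*-monoʳ-≤ c₁ (*-monoʳ-≤ (16 ^ (β * 16))
         (central-term {2} {1} {β * 12} {β * 6} (s≤s z≤n) (s≤s z≤n) (ratio′ β) (parts′ β)))) ⟩
  suc M * (c₁ * (16 ^ (β * 16) * (suc M′ * (c₂ * (2 ^ (β * 12) * 1 ^ (β * 6))))))
    ≡⟨ cong (λ x → suc M * (c₁ * (16 ^ (β * 16) * (suc M′ * (c₂ * (2 ^ (β * 12) * x))))))
            (^-zeroˡ (β * 6)) ⟩
  suc M * (c₁ * (16 ^ (β * 16) * (suc M′ * (c₂ * (2 ^ (β * 12) * 1)))))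
    ≡⟨ regroup (suc M) (suc M′) c₁ c₂ (16 ^ (β * 16)) (2 ^ (β * 12)) ⟩
  suc M * suc M′ * (c₁ * c₂ * (16 ^ (β * 16) * 2 ^ (β * 12)))
    ≡⟨ cong (λ x → suc M * suc M′ * (c₁ * c₂ * x))
            (trans (cong (_* 2 ^ (β * 12)) (^-*-assoc 2 4 (β * 16)))
                   (trans (sym (^-distribˡ-+-* 2 (4 * (β * 16)) (β * 12))) (cong (2 ^_) (exponent′ β)))) ⟩
  suc M * suc M′ * (c₁ * c₂ * 2 ^ (β * 76)) ∎
  where
  M = β * 25
  M′ = β * 9 * 2
  c₁ = M choose (β * 16)
  c₂ = M′ choose (β * 12)
  exponent : ∀ β → β * 50 ≡ 2 * (β * 25)
  exponent = solve-∀
  parts : ∀ β → β * 16 + β * 9 ≡ β * 25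
  parts = solve-∀
  ratio : ∀ β → β * 16 * 9 ≡ β * 9 * 16
  ratio = solve-∀
  parts′ : ∀ β → β * 12 + β * 6 ≡ β * 9 * 2
  parts′ = solve-∀
  ratio′ : ∀ β → β * 12 * 1 ≡ β * 6 * 2
  ratio′ = solve-∀
  exponent′ : ∀ β → 4 * (β * 16) + β * 12 ≡ β * 76
  exponent′ = solve-∀
  regroup : ∀ s s′ c₁ c₂ x y → s * (c₁ * (x * (s′ * (c₂ * (y * 1))))) ≡ s * s′ * (c₁ * c₂ * (x * y))
  regroup = solve-∀

blockC : ∀ γ → let M = γ * 5 * 2 in
  5 ^ (γ * 10) ≤ suc M * ((M choose (γ * 8)) * 2 ^ (γ * 8) * 2 ^ (γ * 8))
blockC γ = begin
  5 ^ (γ * 10)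
    ≡⟨ cong (5 ^_) (exponent γ) ⟩
  (4 + 1) ^ M
    ≤⟨ central-term {4} {1} {γ * 8} {γ * 2} (s≤s z≤n) (s≤s z≤n) (ratio γ) (parts γ) ⟩
  suc M * (c * (4 ^ (γ * 8) * 1 ^ (γ * 2)))
    ≡⟨ cong (λ x → suc M * (c * (4 ^ (γ * 8) * x))) (^-zeroˡ (γ * 2)) ⟩
  suc M * (c * (4 ^ (γ * 8) * 1))
    ≡⟨ cong (λ x → suc M * (c * (x * 1)))
            (trans (^-*-assoc 2 2 (γ * 8)) (^-distribˡ-+-* 2 (γ * 8) (γ * 8 + 0))) ⟩
  suc M * (c * (2 ^ (γ * 8) * 2 ^ (γ * 8 + 0) * 1))
    ≡⟨ cong (λ x → suc M * (c * (2 ^ (γ * 8) * 2 ^ x * 1))) (+-identityʳ (γ * 8)) ⟩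
  suc M * (c * (2 ^ (γ * 8) * 2 ^ (γ * 8) * 1))
    ≡⟨ cong (suc M *_) (regroup c (2 ^ (γ * 8))) ⟩
  suc M * (c * 2 ^ (γ * 8) * 2 ^ (γ * 8)) ∎
  where
  M = γ * 5 * 2
  c = M choose (γ * 8)
  exponent : ∀ γ → γ * 10 ≡ γ * 5 * 2
  exponent = solve-∀
  parts : ∀ γ → γ * 8 + γ * 2 ≡ γ * 5 * 2
  parts = solve-∀
  ratio : ∀ γ → γ * 8 * 1 ≡ γ * 2 * 4
  ratio = solve-∀
  regroup : ∀ c x → c * (x * x * 1) ≡ c * x * x
  regroup = solve-∀

proportional-weight : ∀ α β γ → let D = α * 50 + β * 50 + γ * 10 in
  5 ^ D ≤ suc D ^ 5 * (weight (proportional α β γ) * 2 ^ (α * 80 + β * 76 + γ * 8))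
proportional-weight α β γ = begin
  5 ^ (α * 50 + β * 50 + γ * 10)
    ≡⟨ trans (^-distribˡ-+-* 5 (α * 50 + β * 50) (γ * 10))
             (cong (_* 5 ^ (γ * 10)) (^-distribˡ-+-* 5 (α * 50) (β * 50))) ⟩
  5 ^ (α * 50) * 5 ^ (β * 50) * 5 ^ (γ * 10)
    ≤⟨ *-mono-≤ (*-mono-≤ (blockA α) (blockB β)) (blockC γ) ⟩
  sA * sA′ * (wA * 2 ^ (α * 80)) * (sB * sB′ * (wB * 2 ^ (β * 76))) * (sC * (wC * 2 ^ (γ * 8)))
    ≡⟨ regroup sA sA′ sB sB′ sC wA wB wC (2 ^ (α * 80)) (2 ^ (β * 76)) (2 ^ (γ * 8)) ⟩
  sA * sA′ * sB * sB′ * sC * (wA * wB * wC * (2 ^ (α * 80) * 2 ^ (β * 76) * 2 ^ (γ * 8)))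
    ≤⟨ *-mono-≤ factors (≤-reflexive (cong (wA * wB * wC *_) powers)) ⟩
  suc D ^ 5 * (wA * wB * wC * 2 ^ (α * 80 + β * 76 + γ * 8)) ∎
  where
  D = α * 50 + β * 50 + γ * 10
  sA = suc (α * 25)
  sA′ = suc (α * 8 + α)
  sB = suc (β * 25)
  sB′ = suc (β * 9 * 2)
  sC = suc (γ * 5 * 2)
  wA = ((α * 25) choose (α * 16)) * (((α * 8 + α) choose (α * 8)) * 2 ^ (α * 8))
  wB = ((β * 25) choose (β * 16)) * ((β * 9 * 2) choose (β * 12))
  wC = ((γ * 5 * 2) choose (γ * 8)) * 2 ^ (γ * 8)
  regroup : ∀ a a′ b b′ c x y z X Y Z →
    a * a′ * (x * X) * (b * b′ * (y * Y)) * (c * (z * Z)) ≡ a * a′ * b * b′ * c * (x * y * z * (X * Y * Z))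
  regroup = solve-∀
  ≤D : ∀ x y → x + y ≡ α * 50 + β * 50 + γ * 10 → suc x ≤ suc D
  ≤D x y eq = s≤s (m+n≤o⇒m≤o x (≤-reflexive eq))
  fifth-power : ∀ s → s * s * s * s * s ≡ s * (s * (s * (s * (s * 1))))
  fifth-power = solve-∀
  factors : sA * sA′ * sB * sB′ * sC ≤ suc D ^ 5
  factors = ≤-trans
    (*-mono-≤ (*-mono-≤ (*-mono-≤ (*-mono-≤
      (≤D (α * 25) (α * 25 + β * 50 + γ * 10) (solve (α ∷ β ∷ γ ∷ [])))
      (≤D (α * 8 + α) (α * 41 + β * 50 + γ * 10) (solve (α ∷ β ∷ γ ∷ []))))
      (≤D (β * 25) (α * 50 + β * 25 + γ * 10) (solve (α ∷ β ∷ γ ∷ []))))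
      (≤D (β * 9 * 2) (α * 50 + β * 32 + γ * 10) (solve (α ∷ β ∷ γ ∷ []))))
      (≤D (γ * 5 * 2) (α * 50 + β * 50) (solve (α ∷ β ∷ γ ∷ []))))
    (≤-reflexive (fifth-power (suc D)))
  powers : 2 ^ (α * 80) * 2 ^ (β * 76) * 2 ^ (γ * 8) ≡ 2 ^ (α * 80 + β * 76 + γ * 8)
  powers = sym (trans (^-distribˡ-+-* 2 (α * 80 + β * 76) (γ * 8))
                      (cong (_* 2 ^ (γ * 8)) (^-distribˡ-+-* 2 (α * 80) (β * 76))))

record Balanced (A B C p q r : ℕ) : Set where
  constructor balanced
  field
    x-degree     : 25 * p ≡ 32 * (A + B)
    z-degree     : 25 * r ≡ 2 * A + 6 * B + 10 * C
    total-degree : p + q + r ≡ 2 * (A + B + C)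

hypotheses⇒balanced : ∀ {A B C p q r n} → n ≡ p + q + r →
  32 * A + 25 * p + 200 * r ≡ 40 * n → 32 * B + 40 * n ≡ 50 * p + 200 * r → 32 * C + 25 * p ≡ 16 * n →
  Balanced A B C p q r
hypotheses⇒balanced {A} {B} {C} {p} {q} {r} refl hA hB hC = balanced x-degree z-degree total-degree
  where
  x-degree : 25 * p ≡ 32 * (A + B)
  x-degree = +-cancelʳ-≡ (25 * p + 200 * r + 40 * (p + q + r)) _ _ (begin-equality
    25 * p + (25 * p + 200 * r + 40 * (p + q + r))           ≡⟨ solve (p ∷ q ∷ r ∷ []) ⟩
    40 * (p + q + r) + (50 * p + 200 * r)                    ≡⟨ cong₂ _+_ hA hB ⟨
    32 * A + 25 * p + 200 * r + (32 * B + 40 * (p + q + r))  ≡⟨ solve (A ∷ B ∷ p ∷ q ∷ r ∷ []) ⟩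
    32 * (A + B) + (25 * p + 200 * r + 40 * (p + q + r))     ∎)
  total-degree : p + q + r ≡ 2 * (A + B + C)
  total-degree = *-cancelˡ-≡ _ _ 16 (begin-equality
    16 * (p + q + r)        ≡⟨ hC ⟨
    32 * C + 25 * p         ≡⟨ cong (32 * C +_) x-degree ⟩
    32 * C + 32 * (A + B)   ≡⟨ solve (A ∷ B ∷ C ∷ []) ⟩
    16 * (2 * (A + B + C))  ∎)
  z-degree : 25 * r ≡ 2 * A + 6 * B + 10 * C
  z-degree = *-cancelˡ-≡ _ _ 8 (+-cancelʳ-≡ (64 * A + 32 * B) _ _ (begin-equality
    8 * (25 * r) + (64 * A + 32 * B)                  ≡⟨ solve (A ∷ B ∷ r ∷ []) ⟩
    32 * A + 32 * (A + B) + 200 * r                   ≡⟨ cong (λ x → 32 * A + x + 200 * r) x-degree ⟨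
    32 * A + 25 * p + 200 * r                         ≡⟨ hA ⟩
    40 * (p + q + r)                                  ≡⟨ cong (40 *_) total-degree ⟩
    40 * (2 * (A + B + C))                            ≡⟨ solve (A ∷ B ∷ C ∷ []) ⟩
    8 * (2 * A + 6 * B + 10 * C) + (64 * A + 32 * B)  ∎))

balanced-+ : ∀ {A B C p q r A′ B′ C′ p′ q′ r′} → Balanced A B C p q r → Balanced A′ B′ C′ p′ q′ r′ →
             Balanced (A + A′) (B + B′) (C + C′) (p + p′) (q + q′) (r + r′)
balanced-+ {A} {B} {C} {p} {q} {r} {A′} {B′} {C′} {p′} {q′} {r′} (balanced x z t) (balanced x′ z′ t′) =
  balanced
  (trans (*-distribˡ-+ 25 p p′) (trans (cong₂ _+_ x x′) (solve (A ∷ B ∷ A′ ∷ B′ ∷ []))))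
  (trans (*-distribˡ-+ 25 r r′) (trans (cong₂ _+_ z z′) (solve (A ∷ B ∷ C ∷ A′ ∷ B′ ∷ C′ ∷ []))))
  (begin-equality
    p + p′ + (q + q′) + (r + r′)          ≡⟨ solve (p ∷ q ∷ r ∷ p′ ∷ q′ ∷ r′ ∷ []) ⟩
    p + q + r + (p′ + q′ + r′)            ≡⟨ cong₂ _+_ t t′ ⟩
    2 * (A + B + C) + 2 * (A′ + B′ + C′)  ≡⟨ solve (A ∷ B ∷ C ∷ A′ ∷ B′ ∷ C′ ∷ []) ⟩
    2 * (A + A′ + (B + B′) + (C + C′))    ∎)

balanced-unique : ∀ {A B C p q r p′ q′ r′} → Balanced A B C p q r → Balanced A B C p′ q′ r′ →
                  p ≡ p′ × q ≡ q′ × r ≡ r′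
balanced-unique {p = p} {q} {r} {p′} {q′} {r′} (balanced x z t) (balanced x′ z′ t′) =
  p≡p′ , q≡q′ , r≡r′
  where
  p≡p′ = *-cancelˡ-≡ p p′ 25 (trans x (sym x′))
  r≡r′ = *-cancelˡ-≡ r r′ 25 (trans z (sym z′))
  q≡q′ = +-cancelˡ-≡ p′ q q′ (+-cancelʳ-≡ r′ (p′ + q) (p′ + q′)
           (trans (cong₂ (λ x y → x + q + y) (sym p≡p′) (sym r≡r′)) (trans t (sym t′))))

proportional-balanced : ∀ α β γ →
  Balanced (α * 25) (β * 25) (γ * 5) (α * 32 + β * 32) (α * 16 + β * 12 + γ * 8) (α * 2 + β * 6 + γ * 2)
proportional-balanced α β γ =
  balanced (solve (α ∷ β ∷ [])) (solve (α ∷ β ∷ γ ∷ [])) (solve (α ∷ β ∷ γ ∷ []))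

Residue : ℕ → ℕ → ℕ → Set
Residue a b c = ∃[ p ] ∃[ q ] ∃[ r ] Split a b c p q r × Balanced a b c p q r

residue : ∀ a b c → Maybe (Residue a b c)
residue 0  0  0 = just (_ , _ , _ , split 0  0 0 0  0 0  0 0 0 0 refl refl , balanced refl refl refl)
residue 15 10 1 = just (_ , _ , _ , split 10 5 0 6  4 6  2 1 0 2 refl refl , balanced refl refl refl)
residue 5  20 2 = just (_ , _ , _ , split 5  0 0 11 9 16 2 2 0 4 refl refl , balanced refl refl refl)
residue 20 5  3 = just (_ , _ , _ , split 16 4 0 0  5 10 0 3 2 4 refl refl , balanced refl refl refl)
residue 10 15 4 = just (_ , _ , _ , split 10 0 0 6  9 18 0 4 2 6 refl refl , balanced refl refl refl)
residue _  _  _ = nothing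

residue-complete : ∀ {a} → a < 25 → ∀ {b} → b < 25 → ∀ {c} → c < 5 →
  25 ∣ 32 * (a + b) → 25 ∣ 2 * a + 6 * b + 10 * c → a + b + c ≤ 29 × T (is-just (residue a b c))
residue-complete = from-yes (allUpTo? (λ a → allUpTo? (λ b → allUpTo? (λ c →
  25 ∣? 32 * (a + b) →-dec 25 ∣? 2 * a + 6 * b + 10 * c →-dec
  a + b + c ≤? 29 ×-dec T? (is-just (residue a b c))) 5) 25) 25)

25∣-remainder : ∀ x y z → 25 * x ≡ 25 * z + y → 25 ∣ y
25∣-remainder x y z eq = ∣m+n∣m⇒∣n (subst (25 ∣_) eq (m∣m*n x)) (m∣m*n z)

1+n≤n² : ∀ {n} → 2 ≤ n → suc n ≤ n ^ 2
1+n≤n² {n} 2≤n = begin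
  suc n  ≤⟨ +-monoˡ-≤ n (≤-trans (s≤s z≤n) 2≤n) ⟩
  n + n  ≡⟨ cong (n +_) (+-identityʳ n) ⟨
  2 * n  ≤⟨ *-monoˡ-≤ n 2≤n ⟩
  n * n  ≡⟨ cong (n *_) (*-identityʳ n) ⟨
  n ^ 2  ∎

-- C₀ = 39 = 5 · 2 + 29: each of the five factors M + 1 is at most n², and the residue contributes
-- 5^d ≤ 5^58 ≤ n^29.
weight-bound : ∀ α β γ {A B C p q r} (s : Split A B C p q r) {d n} →
  weight (proportional α β γ) ≤ weight s → α * 80 + β * 76 + γ * 8 ≤ 2 * p + q →
  d ≤ 58 → n ≡ α * 50 + β * 50 + γ * 10 + d → 39 ≤ n →
  5 ^ n ≤ n ^ 39 * (weight s * 2 ^ (2 * p + q))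
weight-bound α β γ {p = p} {q} s {d} {n} w₀≤w E₀≤ d≤58 n≡D+d 39≤n = begin
  5 ^ n
    ≡⟨ trans (cong (5 ^_) n≡D+d) (^-distribˡ-+-* 5 D d) ⟩
  5 ^ D * 5 ^ d
    ≤⟨ *-mono-≤ (proportional-weight α β γ) (^-monoʳ-≤ 5 d≤58) ⟩
  suc D ^ 5 * (w₀ * 2 ^ E₀) * 5 ^ 58
    ≤⟨ *-mono-≤ (*-mono-≤ polynomial (*-mono-≤ w₀≤w (^-monoʳ-≤ 2 E₀≤))) exponential ⟩
  n ^ 10 * (weight s * 2 ^ (2 * p + q)) * n ^ 29
    ≡⟨ regroup (n ^ 10) (weight s * 2 ^ (2 * p + q)) (n ^ 29) ⟩
  n ^ 10 * n ^ 29 * (weight s * 2 ^ (2 * p + q))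
    ≡⟨ cong (_* (weight s * 2 ^ (2 * p + q))) (^-distribˡ-+-* n 10 29) ⟨
  n ^ 39 * (weight s * 2 ^ (2 * p + q)) ∎
  where
  D = α * 50 + β * 50 + γ * 10
  E₀ = α * 80 + β * 76 + γ * 8
  w₀ = weight (proportional α β γ)
  polynomial : suc D ^ 5 ≤ n ^ 10
  polynomial = begin
    suc D ^ 5    ≤⟨ ^-monoˡ-≤ 5 (≤-trans (s≤s (m+n≤o⇒m≤o D (≤-reflexive (sym n≡D+d))))
                                         (1+n≤n² (≤-trans (s≤s (s≤s z≤n)) 39≤n))) ⟩
    (n ^ 2) ^ 5  ≡⟨ ^-*-assoc n 2 5 ⟩
    n ^ 10       ∎
  exponential : 5 ^ 58 ≤ n ^ 29
  exponential = begin
    5 ^ 58   ≡⟨ ^-*-assoc 5 2 29 ⟨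
    25 ^ 29  ≤⟨ ^-monoˡ-≤ 29 (≤-trans (from-yes (25 ≤? 39)) 39≤n) ⟩
    n ^ 29   ∎
  regroup : ∀ a x b → a * x * b ≡ a * b * x
  regroup = solve-∀

HeavySplit : ℕ → ℕ → ℕ → ℕ → ℕ → ℕ → ℕ → Set
HeavySplit n A B C p q r = Σ[ s ∈ Split A B C p q r ] 5 ^ n ≤ n ^ 39 * (weight s * 2 ^ (2 * p + q))

heavy-cong : ∀ {n A B C p q r p′ q′ r′} → p ≡ p′ → q ≡ q′ → r ≡ r′ →
             HeavySplit n A B C p q r → HeavySplit n A B C p′ q′ r′
heavy-cong refl refl refl h = h

heavy-split-from-residue : ∀ α β γ {a b c p q r n} →
  Balanced (a + α * 25) (b + β * 25) (c + γ * 5) p q r → n ≡ p + q + r → 39 ≤ n →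
  a + b + c ≤ 29 → Residue a b c → HeavySplit n (a + α * 25) (b + β * 25) (c + γ * 5) p q r
heavy-split-from-residue α β γ {n = n} bal n≡p+q+r 39≤n a+b+c≤29 (p′ , q′ , r′ , s′ , bal′) =
  heavy-cong {n = n} {p = p′ + p₀} {q′ + q₀} {r′ + r₀} p′+p₀≡p q′+q₀≡q r′+r₀≡r
    ( s′ +ˢ proportional α β γ
    , weight-bound α β γ (s′ +ˢ proportional α β γ) {p′ + q′ + r′} {n}
        (weight-≤-+ˢ s′ (proportional α β γ))
        (≤-trans (m≤n+m _ (2 * p′ + q′)) (≤-reflexive (solve (p′ ∷ q′ ∷ α ∷ β ∷ γ ∷ []))))
        (≤-trans (≤-reflexive (Balanced.total-degree bal′)) (*-monoʳ-≤ 2 a+b+c≤29))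
        (begin-equality
          n                                          ≡⟨ n≡p+q+r ⟩
          _                                          ≡⟨ cong₂ _+_ (cong₂ _+_ p′+p₀≡p q′+q₀≡q) r′+r₀≡r ⟨
          p′ + p₀ + (q′ + q₀) + (r′ + r₀)            ≡⟨ degree p′ q′ r′ α β γ ⟩
          α * 50 + β * 50 + γ * 10 + (p′ + q′ + r′)  ∎)
        39≤n)
  where
  p₀ = α * 32 + β * 32
  q₀ = α * 16 + β * 12 + γ * 8
  r₀ = α * 2 + β * 6 + γ * 2
  degree : ∀ p′ q′ r′ α β γ →
    p′ + (α * 32 + β * 32) + (q′ + (α * 16 + β * 12 + γ * 8)) + (r′ + (α * 2 + β * 6 + γ * 2))
    ≡ α * 50 + β * 50 + γ * 10 + (p′ + q′ + r′)
  degree = solve-∀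
  exponents = balanced-unique (balanced-+ bal′ (proportional-balanced α β γ)) bal
  p′+p₀≡p = proj₁ exponents
  q′+q₀≡q = proj₁ (proj₂ exponents)
  r′+r₀≡r = proj₂ (proj₂ exponents)

heavy-split : ∀ {A B C p q r n} α β γ a b c → A ≡ a + α * 25 → B ≡ b + β * 25 → C ≡ c + γ * 5 →
  a < 25 → b < 25 → c < 5 → Balanced A B C p q r → n ≡ p + q + r → 39 ≤ n → HeavySplit n A B C p q r
heavy-split {p = p} {q} {r} α β γ a b c refl refl refl a<25 b<25 c<5 bal n≡p+q+r 39≤n =
  heavy-split-from-residue α β γ bal n≡p+q+r 39≤n (proj₁ found) (to-witness-T (residue a b c) (proj₂ found))
  where
  found = residue-complete a<25 b<25 c<5
    (25∣-remainder p (32 * (a + b)) (α * 32 + β * 32)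
                   (trans (Balanced.x-degree bal) (solve (a ∷ b ∷ α ∷ β ∷ []))))
    (25∣-remainder r (2 * a + 6 * b + 10 * c) (α * 2 + β * 6 + γ * 2)
                   (trans (Balanced.z-degree bal) (solve (a ∷ b ∷ c ∷ α ∷ β ∷ γ ∷ []))))

mainTheorem1 : ∃[ C₀ ] ∀ (A B C p q r n : ℕ) → C₀ ≤ n → n ≡ p + q + r
    → 32 * A + 25 * p + 200 * r ≡ 40 * n
    → 32 * B + 40 * n ≡ 50 * p + 200 * r
    → 32 * C + 25 * p ≡ 16 * n
    → 5 ^ n ≤ P A B C p q r * (n ^ C₀ * 2 ^ (2 * p + q))
mainTheorem1 = 39 , λ A B C p q r n 39≤n n≡p+q+r hA hB hC →
  let s , 5ⁿ≤ = heavy-split {n = n} (A / 25) (B / 25) (C / 5) (A % 25) (B % 25) (C % 5)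
                  (m≡m%n+[m/n]*n A 25) (m≡m%n+[m/n]*n B 25) (m≡m%n+[m/n]*n C 5)
                  (m%n<n A 25) (m%n<n B 25) (m%n<n C 5)
                  (hypotheses⇒balanced {A} {B} {C} {p} {q} {r} n≡p+q+r hA hB hC) n≡p+q+r 39≤n
  in begin
    5 ^ n                                       ≤⟨ 5ⁿ≤ ⟩
    n ^ 39 * (weight s * 2 ^ (2 * p + q))       ≤⟨ *-monoʳ-≤ (n ^ 39) (*-monoˡ-≤ _ (coefficient-bound s)) ⟩
    n ^ 39 * (P A B C p q r * 2 ^ (2 * p + q))  ≡⟨ *-exchange (n ^ 39) (P A B C p q r) (2 ^ (2 * p + q)) ⟩
    P A B C p q r * (n ^ 39 * 2 ^ (2 * p + q))  ∎
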